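{- For every element $x\in\mathcal{A}$ there exists a positive integer $K_x$ such that $K_x x$ can be represented as a sum of at most $K_x$ primary elements of $\mathcal{A}$ (repetitions allowed).
   Context: Let $G$ be a free abelian group of finite rank $k\ge1$, identified with $\mathbb{Z}^k$, and $\mathcal{A}\subset G$ a finite generating set with $\mathcal{A}=-\mathcal{A}$, $0\notin\mathcal{A}$. $\Gamma=\mathrm{Cay}(G,\mathcal{A})$ has vertex set $G$ and edges $\{x,x+a\}$, $a\in\mathcal{A}$. $\rho(x)$ is the length of a shortest path in $\Gamma$ from $0$ to $x$, $\omega(x)$ the number of such shortest paths. An element $x\in\mathcal{A}$ is primary if $\rho(tx)=t$ and $\omega(tx)=1$ for every integer $t\ge0$. -}

module Defs where

open import Data.Nat using (ℕ; _<_; _≤_)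
open import Data.Integer as ℤ using (ℤ)
open import Data.Vec using (Vec; replicate; zipWith; map; foldr)
open import Data.List as L using (List)
open import Data.List.Membership.Propositional using (_∈_)
open import Data.List.Relation.Unary.All using (All)
open import Data.Product using (Σ; _×_; ∃-syntax; proj₁; proj₂)
open import Data.Vec.Relation.Unary.All as VA using ()
open import Relation.Binary.PropositionalEquality using (_≡_)
open import Relation.Nullary using (¬_)

G : ℕ → Set
G k = Vec ℤ k

0G : ∀ {k} → G k
0G = replicate _ (ℤ.+ 0)

infixl 6 _⊕_
_⊕_ : ∀ {k} → G k → G k → G k
_⊕_ = zipWith ℤ._+_

⊖_ : ∀ {k} → G k → G k
⊖_ = map (λ z → ℤ.- z)

infixr 7 _·_
_·_ : ∀ {k} → ℤ → G k → G k
t · x = map (t ℤ.*_) x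

sumV : ∀ {k n} → Vec (G k) n → G k
sumV = foldr _ _⊕_ 0G

sumL : ∀ {k} → List (G k) → G k
sumL = L.foldr _⊕_ 0G

Symmetric : ∀ {k} → List (G k) → Set
Symmetric 𝒜 = ∀ a → a ∈ 𝒜 → (⊖ a) ∈ 𝒜

Generates : ∀ {k} → List (G k) → Set
Generates {k} 𝒜 = ∀ (g : G k) →
  ∃[ cs ] (All (λ p → proj₂ p ∈ 𝒜) cs
          × sumL (L.map (λ p → proj₁ p · proj₂ p) cs) ≡ g)

-- Walks in Cay(G,𝒜) starting at 0 of length n ending at x.
-- A walk 0 = v₀, v₁, …, vₙ = x with v_{i+1} - v_i ∈ 𝒜 is determined by
-- (and determines) its step vector (v₁ - v₀, …, vₙ - v_{n-1}).
Walk : ∀ {k} → List (G k) → ℕ → G k → Set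
Walk {k} 𝒜 n x = Σ (Vec (G k) n) λ s → VA.All (_∈ 𝒜) s × sumV s ≡ x

HasDist : ∀ {k} → List (G k) → G k → ℕ → Set
HasDist 𝒜 x n = Walk 𝒜 n x × (∀ m → m < n → ¬ Walk 𝒜 m x)

UniqueWalk : ∀ {k} → List (G k) → ℕ → G k → Set
UniqueWalk 𝒜 n x = (w w' : Walk 𝒜 n x) → proj₁ w ≡ proj₁ w'

Primary : ∀ {k} → List (G k) → G k → Set
Primary 𝒜 x = x ∈ 𝒜 × (∀ (t : ℕ) →
  HasDist 𝒜 ((ℤ.+ t) · x) t × UniqueWalk 𝒜 t ((ℤ.+ t) · x))

module Submission where

-- Call e a vertex of a finite set S ⊂ ℤᵏ if some linear functional c is positive at e
-- and strictly smaller than c·e at every other point of S.  Vertices are primary: along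
-- a walk of length m with steps in S the functional grows by at most c·e per step, so a
-- walk to t·e has length m ≥ t, and when m = t every step must be e.  The theorem is
-- then a consequence of a statement about arbitrary finite sets S: for x ∈ S some positive multiple K·x is a sum of at
-- most K vertices of S.  This is proved by induction on |S|, applying Gordan's
-- alternative to the vectors x and x - t (t ∈ T = S ∖ {x}).  Either a functional is
-- positive on all of them, and then x is a vertex of S; or a nonempty sub-multiset sums
-- to zero, which writes r·x as a sum of at most r points of T.  By induction each point
-- of T is a multiple of a short sum of vertices of T, these combine to a representation
-- of x, and a vertex of T is still a vertex of S because c·x < c·p unless x = p.

module Lattice where

  open import Defs
  open import Data.Nat as ℕ using (ℕ; zero; suc)
  open import Data.Integer using (ℤ; +_; 0ℤ; 1ℤ; _+_; _*_; -_)
  import Data.Integer.Properties as ℤP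
  open import Data.Integer.Tactic.RingSolver using (solve-∀)
  open import Data.Vec using (Vec; []; _∷_; head; tail; toList)
  open import Data.List as List using (List; []; _∷_; _++_)
  import Data.List.Properties as ListP
  open import Data.List.Relation.Unary.All using (All; []; _∷_)
  open import Data.List.Relation.Unary.All.Properties using (++⁺)
  open import Relation.Binary.PropositionalEquality

  private variable k : ℕ

  ⊕-identityˡ : (x : G k) → 0G ⊕ x ≡ x
  ⊕-identityˡ [] = refl
  ⊕-identityˡ (a ∷ x) = cong₂ _∷_ (ℤP.+-identityˡ a) (⊕-identityˡ x)

  ⊕-identityʳ : (x : G k) → x ⊕ 0G ≡ x
  ⊕-identityʳ [] = refl
  ⊕-identityʳ (a ∷ x) = cong₂ _∷_ (ℤP.+-identityʳ a) (⊕-identityʳ x)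

  ⊕-assoc : (x y z : G k) → (x ⊕ y) ⊕ z ≡ x ⊕ (y ⊕ z)
  ⊕-assoc [] [] [] = refl
  ⊕-assoc (a ∷ x) (b ∷ y) (c ∷ z) = cong₂ _∷_ (ℤP.+-assoc a b c) (⊕-assoc x y z)

  ⊕-interchange : (w x y z : G k) → (w ⊕ x) ⊕ (y ⊕ z) ≡ (w ⊕ y) ⊕ (x ⊕ z)
  ⊕-interchange [] [] [] [] = refl
  ⊕-interchange (a ∷ w) (b ∷ x) (c ∷ y) (d ∷ z) =
    cong₂ _∷_ (swap a b c d) (⊕-interchange w x y z)
    where
    swap : ∀ a b c d → (a + b) + (c + d) ≡ (a + c) + (b + d)
    swap = solve-∀

  ⊖-cancelʳ : (x y : G k) → (x ⊕ ⊖ y) ⊕ y ≡ x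
  ⊖-cancelʳ [] [] = refl
  ⊖-cancelʳ (a ∷ x) (b ∷ y) = cong₂ _∷_ (cancel a b) (⊖-cancelʳ x y)
    where
    cancel : ∀ a b → (a + - b) + b ≡ a
    cancel = solve-∀

  ·-distribˡ-⊕ : ∀ t (x y : G k) → t · (x ⊕ y) ≡ t · x ⊕ t · y
  ·-distribˡ-⊕ t [] [] = refl
  ·-distribˡ-⊕ t (a ∷ x) (b ∷ y) = cong₂ _∷_ (ℤP.*-distribˡ-+ t a b) (·-distribˡ-⊕ t x y)

  ·-assoc : ∀ s t (x : G k) → (s * t) · x ≡ s · (t · x)
  ·-assoc s t [] = refl
  ·-assoc s t (a ∷ x) = cong₂ _∷_ (ℤP.*-assoc s t a) (·-assoc s t x)

  ·-zeroˡ : (x : G k) → (+ 0) · x ≡ 0G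
  ·-zeroˡ [] = refl
  ·-zeroˡ (a ∷ x) = cong (0ℤ ∷_) (·-zeroˡ x)

  ·-zeroʳ : ∀ t → t · 0G {k} ≡ 0G
  ·-zeroʳ {zero} t = refl
  ·-zeroʳ {suc k} t = cong₂ _∷_ (ℤP.*-zeroʳ t) (·-zeroʳ t)

  ·-suc : ∀ n (x : G k) → (+ suc n) · x ≡ x ⊕ (+ n) · x
  ·-suc n [] = refl
  ·-suc n (a ∷ x) = cong₂ _∷_ (distrib (+ n) a) (·-suc n x)
    where
    distrib : ∀ m a → (1ℤ + m) * a ≡ a + m * a
    distrib = solve-∀

  ·-cancelˡ : ∀ {r} → 0 ℕ.< r → (x y : G k) → (+ r) · x ≡ (+ r) · y → x ≡ y
  ·-cancelˡ r>0 [] [] eq = refl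
  ·-cancelˡ {r = suc n} r>0 (a ∷ x) (b ∷ y) eq =
    cong₂ _∷_ (ℤP.*-cancelˡ-≡ (+ suc n) a b (cong head eq)) (·-cancelˡ r>0 x y (cong tail eq))

  ∷-eta : (x : G (suc k)) → x ≡ head x ∷ tail x
  ∷-eta (a ∷ x) = refl

  lincomb-∷ : ∀ s t (x y : G (suc k)) →
    s · x ⊕ t · y ≡ (s * head x + t * head y) ∷ (s · tail x ⊕ t · tail y)
  lincomb-∷ s t (a ∷ x) (b ∷ y) = refl

  dot : G k → G k → ℤ
  dot [] [] = 0ℤ
  dot (c ∷ cs) (x ∷ xs) = c * x + dot cs xs

  dot-⊕ : (c x y : G k) → dot c (x ⊕ y) ≡ dot c x + dot c y
  dot-⊕ [] [] [] = refl
  dot-⊕ (c ∷ cs) (a ∷ x) (b ∷ y) rewrite dot-⊕ cs x y = distrib c a b (dot cs x) (dot cs y)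
    where
    distrib : ∀ c a b u v → c * (a + b) + (u + v) ≡ (c * a + u) + (c * b + v)
    distrib = solve-∀

  dot-· : (c : G k) (t : ℤ) (x : G k) → dot c (t · x) ≡ t * dot c x
  dot-· [] t [] = sym (ℤP.*-zeroʳ t)
  dot-· (c ∷ cs) t (a ∷ x) rewrite dot-· cs t x = factor c t a (dot cs x)
    where
    factor : ∀ c t a u → c * (t * a) + t * u ≡ t * (c * a + u)
    factor = solve-∀

  dot-·ˡ : (c : G k) (t : ℤ) (x : G k) → dot (t · c) x ≡ t * dot c x
  dot-·ˡ [] t [] = sym (ℤP.*-zeroʳ t)
  dot-·ˡ (c ∷ cs) t (a ∷ x) rewrite dot-·ˡ cs t x = factor c t a (dot cs x)
    where
    factor : ∀ c t a u → (t * c) * a + t * u ≡ t * (c * a + u)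
    factor = solve-∀

  dot-⊖ : (c x : G k) → dot c (⊖ x) ≡ - dot c x
  dot-⊖ [] [] = refl
  dot-⊖ (c ∷ cs) (a ∷ x) rewrite dot-⊖ cs x = negate c a (dot cs x)
    where
    negate : ∀ c a u → c * (- a) + (- u) ≡ - (c * a + u)
    negate = solve-∀

  dot-∷ : ∀ c₀ (c : G k) x → dot (c₀ ∷ c) x ≡ c₀ * head x + dot c (tail x)
  dot-∷ c₀ c (a ∷ x) = refl

  sumL-++ : (xs ys : List (G k)) → sumL (xs ++ ys) ≡ sumL xs ⊕ sumL ys
  sumL-++ [] ys = sym (⊕-identityˡ (sumL ys))
  sumL-++ (x ∷ xs) ys rewrite sumL-++ xs ys = sym (⊕-assoc x (sumL xs) (sumL ys))

  sumV-toList : ∀ {n} (s : Vec (G k) n) → sumV s ≡ sumL (toList s)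
  sumV-toList [] = refl
  sumV-toList (x ∷ s) = cong (x ⊕_) (sumV-toList s)

  sumL-replicate : ∀ n (x : G k) → sumL (List.replicate n x) ≡ (+ n) · x
  sumL-replicate zero x = sym (·-zeroˡ x)
  sumL-replicate (suc n) x = trans (cong (x ⊕_) (sumL-replicate n x)) (sym (·-suc n x))

  all-equal : ∀ {A : Set} {e : A} (ys : List A) → All (_≡ e) ys → ys ≡ List.replicate (List.length ys) e
  all-equal [] [] = refl
  all-equal (y ∷ ys) (refl ∷ eqs) = cong (y ∷_) (all-equal ys eqs)

  sumL-all-equal : ∀ {e : G k} ys → All (_≡ e) ys → sumL ys ≡ (+ List.length ys) · e
  sumL-all-equal {e = e} ys all-e = trans (cong sumL (all-equal ys all-e)) (sumL-replicate (List.length ys) e)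

  copies : ∀ {A : Set} → ℕ → List A → List A
  copies zero xs = []
  copies (suc m) xs = xs ++ copies m xs

  length-copies : ∀ {A : Set} m (xs : List A) → List.length (copies m xs) ≡ m ℕ.* List.length xs
  length-copies zero xs = refl
  length-copies (suc m) xs = trans (ListP.length-++ xs) (cong (List.length xs ℕ.+_) (length-copies m xs))

  sumL-copies : ∀ m (xs : List (G k)) → sumL (copies m xs) ≡ (+ m) · sumL xs
  sumL-copies zero xs = sym (·-zeroˡ (sumL xs))
  sumL-copies (suc m) xs =
    trans (sumL-++ xs (copies m xs)) (trans (cong (sumL xs ⊕_) (sumL-copies m xs)) (sym (·-suc m (sumL xs))))

  All-copies : ∀ {A : Set} {P : A → Set} m {xs : List A} → All P xs → All P (copies m xs)
  All-copies zero all-P = []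
  All-copies (suc m) all-P = ++⁺ all-P (All-copies m all-P)

-- Gordan's alternative, proved by Fourier–Motzkin elimination of the first coordinate.
module Gordan where

  open import Defs
  open Lattice
  open import Data.Nat as ℕ using (ℕ; zero; suc; z≤n; s≤s)
  open import Data.Integer using (ℤ; +_; +[1+_]; -[1+_]; 0ℤ; 1ℤ; _+_; _*_; -_; _-_; _≤_; _<_; +≤+; +<+; -≤+; ∣_∣)
  import Data.Integer.Properties as ℤP
  import Data.Nat.Properties as ℕP
  open import Data.Integer.Tactic.RingSolver using (solve-∀)
  import Data.Rational.Unnormalised.Base as ℚᵘ
  import Data.Rational.Unnormalised.Properties as ℚᵘP
  open import Data.List.Extrema ℚᵘP.≤-totalOrder using (argmin; f[argmin]≤f[⊤]; f[argmin]≤f[xs]; argmin-sel)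
  open import Data.Vec using ([]; _∷_; head; tail)
  open import Data.List as List using (List; []; _∷_; _++_; [_]; length; map; replicate; filter; concat)
  import Data.List.Properties as ListP
  open import Data.List.Membership.Propositional using (_∈_)
  open import Data.List.Membership.Propositional.Properties
    using (∈-filter⁺; ∈-filter⁻; ∈-map⁺; ∈-map⁻; ∈-++⁺ˡ; ∈-++⁺ʳ; ∈-++⁻; ∈-cartesianProductWith⁺; ∈-cartesianProductWith⁻)
  open import Data.List.Relation.Unary.All as All using (All; []; _∷_)
  open import Data.List.Relation.Unary.All.Properties using (++⁺; concat⁺; replicate⁺)
  open import Data.List.Relation.Unary.Any using (here; there)
  open import Data.Product using (Σ; _×_; _,_; proj₁; proj₂)
  open import Data.Sum using (_⊎_; inj₁; inj₂; [_,_]′)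
  open import Data.Empty using (⊥-elim)
  open import Function using (case_of_)
  open import Relation.Binary.Definitions using (tri<; tri≈; tri>)
  open import Relation.Binary.PropositionalEquality hiding ([_])

  private variable
    k : ℕ
    I : Set

  bounded : (f : I → ℤ) (W : List I) → Σ ℕ λ B → ∀ {i} → i ∈ W → ∣ f i ∣ ℕ.< B
  bounded f [] = 0 , λ ()
  bounded f (j ∷ W) with bounded f W
  ... | B , below = suc (∣ f j ∣ ℕ.+ B) , λ
    { (here refl) → s≤s (ℕP.m≤m+n ∣ f j ∣ B)
    ; (there i∈W) → ℕP.m<n⇒m<1+n (ℕP.<-≤-trans (below i∈W) (ℕP.m≤n+m B ∣ f j ∣)) }

  0<+ : ∀ i {j} → - i < j → 0ℤ < i + j
  0<+ i -i<j = subst (_< i + _) (ℤP.+-inverseʳ i) (ℤP.+-monoʳ-< i -i<j)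

  B≤B*X : ∀ B {X} → 0ℤ < X → + B ≤ + B * X
  B≤B*X B 0<X = subst (_≤ + B * _) (ℤP.*-identityʳ (+ B)) (ℤP.*-monoˡ-≤-nonNeg (+ B) (ℤP.i<j⇒suc[i]≤j 0<X))

  threshold : ∀ h B X → ∣ h ∣ ℕ.< B → (0ℤ < h → 0ℤ ≤ X) → (h ≤ 0ℤ → 0ℤ < X) → 0ℤ < h + + B * X
  threshold +[1+ a ] B X _ nonneg _ = ℤP.<-≤-trans (+<+ (s≤s z≤n)) h≤h+BX
    where
    0≤BX : 0ℤ ≤ + B * X
    0≤BX = subst (_≤ + B * X) (ℤP.*-zeroʳ (+ B)) (ℤP.*-monoˡ-≤-nonNeg (+ B) (nonneg (+<+ (s≤s z≤n))))
    h≤h+BX : +[1+ a ] ≤ +[1+ a ] + + B * X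
    h≤h+BX = subst (_≤ +[1+ a ] + + B * X) (ℤP.+-identityʳ +[1+ a ]) (ℤP.+-monoʳ-≤ +[1+ a ] 0≤BX)
  threshold (+ 0) B X ∣h∣<B _ pos = 0<+ (+ 0) (ℤP.<-≤-trans (+<+ ∣h∣<B) (B≤B*X B (pos (+≤+ z≤n))))
  threshold -[1+ a ] B X ∣h∣<B _ pos = 0<+ -[1+ a ] (ℤP.<-≤-trans (+<+ ∣h∣<B) (B≤B*X B (pos -≤+)))

  pos*pos : ∀ {a b} → 0ℤ < a → 0ℤ < b → 0ℤ < a * b
  pos*pos {+[1+ m ]} {+[1+ n ]} _ _ = +<+ (s≤s z≤n)
  pos*pos {+ 0} (+<+ ())
  pos*pos {+[1+ m ]} {+ 0} _ (+<+ ())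

  ∣pos∣ : ∀ {i} → 0ℤ < i → + ∣ i ∣ ≡ i
  ∣pos∣ {+[1+ n ]} _ = refl
  ∣pos∣ {+ 0} (+<+ ())

  ∣neg∣ : ∀ {i} → i < 0ℤ → + ∣ i ∣ ≡ - i
  ∣neg∣ { -[1+ n ]} _ = refl
  ∣neg∣ {+ n} (+<+ ())

  ∣neg∣>0 : ∀ {i} → i < 0ℤ → 0 ℕ.< ∣ i ∣
  ∣neg∣>0 { -[1+ n ]} _ = s≤s z≤n
  ∣neg∣>0 {+ n} (+<+ ())

  PositiveFunctional : (I → G k) → List I → Set
  PositiveFunctional {k = k} v W = Σ (G k) λ c → ∀ {i} → i ∈ W → 0ℤ < dot c (v i)

  ZeroSum : (I → G k) → List I → Set
  ZeroSum {I = I} v W = Σ (List I) λ L → 0 ℕ.< length L × All (_∈ W) L × sumL (map v L) ≡ 0G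

  -- One elimination step: the family v in ℤ^(1+k) is reduced to a family u in ℤᵏ
  -- indexed by balanced sub-multisets of W (those whose first coordinates sum to 0).
  module Elimination {I : Set} (v : I → G (suc k)) (W : List I) where

    hd : I → ℤ
    hd i = head (v i)

    tl : I → G k
    tl i = tail (v i)

    Σv : List I → G (suc k)
    Σv L = sumL (map v L)

    Balanced : List I → Set
    Balanced L = 0 ℕ.< length L × All (_∈ W) L × head (Σv L) ≡ 0ℤ

    u : List I → G k
    u L = tail (Σv L)

    pair : I → I → List I
    pair p n = replicate (∣ hd n ∣) p ++ replicate (∣ hd p ∣) n

    Zs Ps Ns : List I
    Zs = filter (λ i → hd i ℤP.≟ 0ℤ) W
    Ps = filter (λ i → 0ℤ ℤP.<? hd i) W
    Ns = filter (λ i → hd i ℤP.<? 0ℤ) W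

    U : List (List I)
    U = map [_] Zs ++ List.cartesianProductWith pair Ps Ns

    Σv-pair : ∀ p n → Σv (pair p n) ≡ (+ ∣ hd n ∣) · v p ⊕ (+ ∣ hd p ∣) · v n
    Σv-pair p n = begin
      sumL (map v (replicate a p ++ replicate b n))
        ≡⟨ cong sumL (trans (ListP.map-++ v (replicate a p) _) (cong₂ _++_ (ListP.map-replicate v a p) (ListP.map-replicate v b n))) ⟩
      sumL (replicate a (v p) ++ replicate b (v n))
        ≡⟨ sumL-++ (replicate a (v p)) _ ⟩
      sumL (replicate a (v p)) ⊕ sumL (replicate b (v n))
        ≡⟨ cong₂ _⊕_ (sumL-replicate a (v p)) (sumL-replicate b (v n)) ⟩
      (+ a) · v p ⊕ (+ b) · v n ∎
      where
      open ≡-Reasoning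
      a = ∣ hd n ∣
      b = ∣ hd p ∣

    u-pair : ∀ p n → u (pair p n) ≡ (+ ∣ hd n ∣) · tl p ⊕ (+ ∣ hd p ∣) · tl n
    u-pair p n = cong tail (trans (Σv-pair p n) (lincomb-∷ (+ ∣ hd n ∣) (+ ∣ hd p ∣) (v p) (v n)))

    u-single : ∀ i → u [ i ] ≡ tl i
    u-single i = cong tail (⊕-identityʳ (v i))

    pair-balanced : ∀ {p n} → p ∈ W → 0ℤ < hd p → n ∈ W → hd n < 0ℤ → Balanced (pair p n)
    pair-balanced {p} {n} p∈W hp>0 n∈W hn<0 = nonempty , ++⁺ (replicate⁺ (∣ hd n ∣) p∈W) (replicate⁺ (∣ hd p ∣) n∈W) , head0
      where
      nonempty : 0 ℕ.< length (pair p n)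
      nonempty = ℕP.<-≤-trans (subst (0 ℕ.<_) (sym (ListP.length-replicate (∣ hd n ∣) {p})) (∣neg∣>0 hn<0))
                              (ListP.length-++-≤ˡ (replicate (∣ hd n ∣) p))
      head0 : head (Σv (pair p n)) ≡ 0ℤ
      head0 = begin
        head (Σv (pair p n))                          ≡⟨ cong head (trans (Σv-pair p n) (lincomb-∷ (+ ∣ hd n ∣) (+ ∣ hd p ∣) (v p) (v n))) ⟩
        + ∣ hd n ∣ * hd p + + ∣ hd p ∣ * hd n         ≡⟨ cong₂ (λ a b → a * hd p + b * hd n) (∣neg∣ hn<0) (∣pos∣ hp>0) ⟩
        - hd n * hd p + hd p * hd n                   ≡⟨ cancel (hd p) (hd n) ⟩
        0ℤ ∎
        where
        open ≡-Reasoning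
        cancel : ∀ a b → - b * a + a * b ≡ 0ℤ
        cancel = solve-∀

    single-balanced : ∀ {i} → i ∈ W → hd i ≡ 0ℤ → Balanced [ i ]
    single-balanced {i} i∈W h≡0 = s≤s z≤n , i∈W ∷ [] , trans (cong head (⊕-identityʳ (v i))) h≡0

    single∈U : ∀ {i} → i ∈ W → hd i ≡ 0ℤ → [ i ] ∈ U
    single∈U i∈W h≡0 = ∈-++⁺ˡ (∈-map⁺ [_] (∈-filter⁺ (λ i → hd i ℤP.≟ 0ℤ) i∈W h≡0))

    pair∈U : ∀ {p n} → p ∈ W → 0ℤ < hd p → n ∈ W → hd n < 0ℤ → pair p n ∈ U
    pair∈U p∈W hp>0 n∈W hn<0 = ∈-++⁺ʳ (map [_] Zs) (∈-cartesianProductWith⁺ pair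
      (∈-filter⁺ (λ i → 0ℤ ℤP.<? hd i) p∈W hp>0) (∈-filter⁺ (λ i → hd i ℤP.<? 0ℤ) n∈W hn<0))

    U-balanced : ∀ {L} → L ∈ U → Balanced L
    U-balanced L∈U with ∈-++⁻ (map [_] Zs) L∈U
    ... | inj₁ L∈singles with ∈-map⁻ [_] L∈singles
    ...   | i , i∈Zs , refl = let i∈W , h≡0 = ∈-filter⁻ (λ i → hd i ℤP.≟ 0ℤ) i∈Zs in single-balanced i∈W h≡0
    U-balanced L∈U | inj₂ L∈pairs with ∈-cartesianProductWith⁻ pair Ps Ns L∈pairs
    ... | p , n , p∈Ps , n∈Ns , refl =
      let p∈W , hp>0 = ∈-filter⁻ (λ i → 0ℤ ℤP.<? hd i) p∈Ps
          n∈W , hn<0 = ∈-filter⁻ (λ i → hd i ℤP.<? 0ℤ) n∈Ns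
      in pair-balanced p∈W hp>0 n∈W hn<0

    Σv-concat : ∀ Ls → All Balanced Ls → Σv (concat Ls) ≡ 0ℤ ∷ sumL (map u Ls)
    Σv-concat [] [] = refl
    Σv-concat (L ∷ Ls) ((_ , _ , head≡0) ∷ balanced) = begin
      sumL (map v (L ++ concat Ls))        ≡⟨ cong sumL (ListP.map-++ v L (concat Ls)) ⟩
      sumL (map v L ++ map v (concat Ls))  ≡⟨ sumL-++ (map v L) (map v (concat Ls)) ⟩
      Σv L ⊕ Σv (concat Ls)                ≡⟨ cong₂ _⊕_ (trans (∷-eta (Σv L)) (cong (_∷ u L) head≡0)) (Σv-concat Ls balanced) ⟩
      (0ℤ ∷ u L) ⊕ (0ℤ ∷ sumL (map u Ls))  ∎
      where open ≡-Reasoning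

    lift-zero-sum : ZeroSum u U → ZeroSum v W
    lift-zero-sum ([] , () , _)
    lift-zero-sum (L ∷ Ls , _ , Ls⊆U , sum≡0) =
      concat (L ∷ Ls) , nonempty , concat⁺ (All.map (λ b → proj₁ (proj₂ b)) balanced) ,
      trans (Σv-concat (L ∷ Ls) balanced) (cong (0ℤ ∷_) sum≡0)
      where
      balanced : All Balanced (L ∷ Ls)
      balanced = All.map U-balanced Ls⊆U
      nonempty : 0 ℕ.< length (concat (L ∷ Ls))
      nonempty = ℕP.<-≤-trans (proj₁ (All.head balanced)) (ListP.length-++-≤ˡ L)

    module Lift (c′ : G k) (c′-pos : ∀ {L} → L ∈ U → 0ℤ < dot c′ (u L)) where

      β : I → ℤ
      β i = dot c′ (tl i)

      -- hd m · β i - hd i · β m, which is positive iff β i/hd i > β m/hd m when hd i, hd m > 0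
      excess : I → I → ℤ
      excess m i = hd m * β i - hd i * β m

      β-zero : ∀ {i} → i ∈ W → hd i ≡ 0ℤ → 0ℤ < β i
      β-zero {i} i∈W h≡0 = subst (λ x → 0ℤ < dot c′ x) (u-single i) (c′-pos (single∈U i∈W h≡0))

      β-pair : ∀ {p n} → p ∈ W → 0ℤ < hd p → n ∈ W → hd n < 0ℤ → 0ℤ < excess p n
      β-pair {p} {n} p∈W hp>0 n∈W hn<0 = subst (0ℤ <_) value (c′-pos (pair∈U p∈W hp>0 n∈W hn<0))
        where
        open ≡-Reasoning
        rearrange : ∀ a b x y → - b * x + a * y ≡ a * y - b * x
        rearrange = solve-∀
        value : dot c′ (u (pair p n)) ≡ excess p n
        value = begin
          dot c′ (u (pair p n))
            ≡⟨ cong (dot c′) (u-pair p n) ⟩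
          dot c′ ((+ ∣ hd n ∣) · tl p ⊕ (+ ∣ hd p ∣) · tl n)
            ≡⟨ dot-⊕ c′ ((+ ∣ hd n ∣) · tl p) ((+ ∣ hd p ∣) · tl n) ⟩
          dot c′ ((+ ∣ hd n ∣) · tl p) + dot c′ ((+ ∣ hd p ∣) · tl n)
            ≡⟨ cong₂ _+_ (dot-· c′ (+ ∣ hd n ∣) (tl p)) (dot-· c′ (+ ∣ hd p ∣) (tl n)) ⟩
          + ∣ hd n ∣ * β p + + ∣ hd p ∣ * β n
            ≡⟨ cong₂ (λ a b → a * β p + b * β n) (∣neg∣ hn<0) (∣pos∣ hp>0) ⟩
          - hd n * β p + hd p * β n
            ≡⟨ rearrange (hd p) (hd n) (β p) (β n) ⟩
          excess p n ∎

      lift-nonpositive : (∀ {i} → i ∈ W → hd i ≤ 0ℤ) → PositiveFunctional v W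
      lift-nonpositive nonpos with bounded β W
      ... | B , β<B = (- + B) ∷ c′ , positive
        where
        rearrange : ∀ b h x → - b * h + x ≡ x + b * - h
        rearrange = solve-∀
        -hd>0 : ∀ {i} → i ∈ W → β i ≤ 0ℤ → 0ℤ < - hd i
        -hd>0 {i} i∈W β≤0 with ℤP.<-cmp (hd i) 0ℤ
        ... | tri< h<0 _ _ = ℤP.neg-mono-< h<0
        ... | tri≈ _ h≡0 _ = ⊥-elim (ℤP.<⇒≱ (β-zero i∈W h≡0) β≤0)
        ... | tri> _ _ h>0 = ⊥-elim (ℤP.<⇒≱ h>0 (nonpos i∈W))
        positive : ∀ {i} → i ∈ W → 0ℤ < dot ((- + B) ∷ c′) (v i)
        positive {i} i∈W =
          subst (0ℤ <_) (sym (trans (dot-∷ (- + B) c′ (v i)) (rearrange (+ B) (hd i) (β i))))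
            (threshold (β i) B (- hd i) (β<B i∈W) (λ _ → ℤP.neg-mono-≤ (nonpos i∈W)) (-hd>0 i∈W))

      -- if m has positive first coordinate and minimises β/hd among those,
      -- c = (1 - B·β m) ∷ (B·hd m)·c′ works for B > all ∣hd i∣
      lift-minimal : ∀ {m} → m ∈ W → 0ℤ < hd m → (∀ {p} → p ∈ W → 0ℤ < hd p → 0ℤ ≤ excess m p) →
                     PositiveFunctional v W
      lift-minimal {m} m∈W hm>0 minimal with bounded hd W
      ... | B , hd<B = (1ℤ - + B * β m) ∷ (+ B * hd m) · c′ , positive
        where
        rearrange : ∀ B b a h x → (1ℤ - B * b) * h + B * a * x ≡ h + B * (a * x - h * b)
        rearrange = solve-∀
        drop-zero : ∀ a b → a - 0ℤ * b ≡ a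
        drop-zero = solve-∀
        excess>0 : ∀ {i} → i ∈ W → hd i ≤ 0ℤ → 0ℤ < excess m i
        excess>0 {i} i∈W h≤0 with ℤP.<-cmp (hd i) 0ℤ
        ... | tri< h<0 _ _ = β-pair m∈W hm>0 i∈W h<0
        ... | tri≈ _ h≡0 _ = subst (0ℤ <_) (sym (trans (cong (λ h → hd m * β i - h * β m) h≡0) (drop-zero (hd m * β i) (β m))))
                                (pos*pos hm>0 (β-zero i∈W h≡0))
        ... | tri> _ _ h>0 = ⊥-elim (ℤP.<⇒≱ h>0 h≤0)
        value : ∀ i → dot ((1ℤ - + B * β m) ∷ (+ B * hd m) · c′) (v i) ≡ hd i + + B * excess m i
        value i = trans (dot-∷ (1ℤ - + B * β m) ((+ B * hd m) · c′) (v i))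
                    (trans (cong (λ x → (1ℤ - + B * β m) * hd i + x) (dot-·ˡ c′ (+ B * hd m) (tl i)))
                      (rearrange (+ B) (β m) (hd m) (hd i) (β i)))
        positive : ∀ {i} → i ∈ W → 0ℤ < dot ((1ℤ - + B * β m) ∷ (+ B * hd m) · c′) (v i)
        positive {i} i∈W = subst (0ℤ <_) (sym (value i))
          (threshold (hd i) B (excess m i) (hd<B i∈W) (minimal i∈W) (excess>0 i∈W))

      -- β/hd as a rational number, meaningful where hd is positive
      ratio : I → ℚᵘ.ℚᵘ
      ratio i = ℚᵘ.mkℚᵘ (β i) (ℕ.pred ∣ hd i ∣)

      ratio-≤ : ∀ {m p} → 0ℤ < hd m → 0ℤ < hd p → ratio m ℚᵘ.≤ ratio p → 0ℤ ≤ excess m p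
      ratio-≤ {m} {p} hm>0 hp>0 (ℚᵘ.*≤* cross) =
        subst (0ℤ ≤_) (rearrange (hd m) (hd p) (β m) (β p))
          (ℤP.i≤j⇒0≤j-i (subst₂ (λ a b → β m * a ≤ β p * b) (denominator hp>0) (denominator hm>0) cross))
        where
        rearrange : ∀ a b x y → y * a - x * b ≡ a * y - b * x
        rearrange = solve-∀
        denominator : ∀ {a} → 0ℤ < a → + suc (ℕ.pred ∣ a ∣) ≡ a
        denominator {+[1+ n ]} _ = refl
        denominator {+ 0} (+<+ ())

      lift-from : (Qs : List I) → (∀ {p} → p ∈ Qs → p ∈ W × 0ℤ < hd p) →
                  (∀ {p} → p ∈ W → 0ℤ < hd p → p ∈ Qs) → PositiveFunctional v W
      lift-from [] _ complete = lift-nonpositive (λ i∈W → ℤP.≮⇒≥ (λ h>0 → case complete i∈W h>0 of λ ()))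
      lift-from (q ∷ qs) sound complete = lift-minimal m∈W hm>0 minimal
        where
        m : I
        m = argmin ratio q qs
        m∈Qs : m ∈ q ∷ qs
        m∈Qs = [ here , there ]′ (argmin-sel ratio q qs)
        m∈W = proj₁ (sound m∈Qs)
        hm>0 = proj₂ (sound m∈Qs)
        ratio-min : ∀ {p} → p ∈ q ∷ qs → ratio m ℚᵘ.≤ ratio p
        ratio-min (here refl) = f[argmin]≤f[⊤] {f = ratio} q qs
        ratio-min (there p∈qs) = All.lookup (f[argmin]≤f[xs] {f = ratio} q qs) p∈qs
        minimal : ∀ {p} → p ∈ W → 0ℤ < hd p → 0ℤ ≤ excess m p
        minimal p∈W hp>0 = ratio-≤ hm>0 hp>0 (ratio-min (complete p∈W hp>0))

      lift : PositiveFunctional v W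
      lift = lift-from Ps (∈-filter⁻ (λ i → 0ℤ ℤP.<? hd i)) (∈-filter⁺ (λ i → 0ℤ ℤP.<? hd i))

  gordan : ∀ k {I : Set} (v : I → G k) (W : List I) → PositiveFunctional v W ⊎ ZeroSum v W
  gordan zero v [] = inj₁ ([] , λ ())
  gordan zero v (i ∷ W) = inj₂ ([ i ] , s≤s z≤n , here refl ∷ [] , G₀-trivial (sumL (map v [ i ])))
    where
    G₀-trivial : (x : G 0) → x ≡ 0G
    G₀-trivial [] = refl
  gordan (suc k) v W with gordan k (Elimination.u v W) (Elimination.U v W)
  ... | inj₁ (c′ , c′-pos) = inj₁ (Elimination.Lift.lift v W c′ c′-pos)
  ... | inj₂ zero-sum = inj₂ (Elimination.lift-zero-sum v W zero-sum)

module Vertices where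

  open import Defs
  open Lattice
  open import Data.Nat as ℕ using (ℕ; zero; suc)
  open import Data.Integer using (ℤ; +_; +[1+_]; 0ℤ; 1ℤ; _+_; _*_; _≤_; _<_; +<+; +≤+)
  import Data.Integer.Properties as ℤP
  open import Data.Integer.Tactic.RingSolver using (solve-∀)
  open import Data.Vec as Vec using (Vec; []; _∷_; toList)
  import Data.Vec.Properties as VecP
  import Data.Vec.Relation.Unary.All as VecAll
  import Data.Vec.Relation.Unary.All.Properties as VecAllP
  open import Data.List using (List; []; _∷_; length)
  open import Data.List.Membership.Propositional using (_∈_)
  open import Data.List.Relation.Unary.All using (All; []; _∷_)
  open import Data.Product using (Σ; _×_; _,_; proj₁; proj₂)
  open import Relation.Nullary using (¬_)
  open import Data.Sum using (_⊎_; inj₁; inj₂)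
  open import Data.Empty using (⊥-elim)
  open import Relation.Binary.PropositionalEquality

  private variable k : ℕ

  Vertex : List (G k) → G k → Set
  Vertex {k} S e = e ∈ S × Σ (G k) λ c → 0ℤ < dot c e × (∀ {s} → s ∈ S → s ≡ e ⊎ dot c s < dot c e)

  module Supporting (S : List (G k)) (e c : G k) (supports : ∀ {s} → s ∈ S → s ≡ e ⊎ dot c s < dot c e) where

    D : ℤ
    D = dot c e

    sum-all-e : ∀ ys → All (_≡ e) ys → dot c (sumL ys) ≡ + length ys * D
    sum-all-e ys all-e = trans (cong (dot c) (sumL-all-equal ys all-e)) (dot-· c (+ length ys) e)

    bound-weaken : ∀ ys → All (_≡ e) ys ⊎ dot c (sumL ys) < + length ys * D → dot c (sumL ys) ≤ + length ys * D
    bound-weaken ys (inj₁ all-e) = ℤP.≤-reflexive (sum-all-e ys all-e)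
    bound-weaken ys (inj₂ below) = ℤP.<⇒≤ below

    bound-∷ : ∀ y ys → dot c y + dot c (sumL ys) < D + + length ys * D → dot c (sumL (y ∷ ys)) < + length (y ∷ ys) * D
    bound-∷ y ys lt = subst₂ _<_ (sym (dot-⊕ c y (sumL ys))) (sym (distrib (+ length ys) D)) lt
      where
      distrib : ∀ m d → (1ℤ + m) * d ≡ d + m * d
      distrib = solve-∀

    sum-bound : ∀ ys → All (_∈ S) ys → All (_≡ e) ys ⊎ dot c (sumL ys) < + length ys * D
    sum-bound [] [] = inj₁ []
    sum-bound (y ∷ ys) (y∈S ∷ ys⊆S) with supports y∈S | sum-bound ys ys⊆S
    ... | inj₁ refl | inj₁ all-e = inj₁ (refl ∷ all-e)
    ... | inj₁ refl | inj₂ below = inj₂ (bound-∷ e ys (ℤP.+-mono-≤-< (ℤP.≤-refl {D}) below))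
    ... | inj₂ y-below | rest = inj₂ (bound-∷ y ys (ℤP.+-mono-<-≤ y-below (bound-weaken ys rest)))

    sum-bound-≤ : ∀ ys → All (_∈ S) ys → dot c (sumL ys) ≤ + length ys * D
    sum-bound-≤ ys ys⊆S = bound-weaken ys (sum-bound ys ys⊆S)

  module Steps {S : List (G k)} {m x} (w : Walk S m x) where

    steps : List (G k)
    steps = toList (proj₁ w)

    steps-in : All (_∈ S) steps
    steps-in = VecAllP.toList⁺ (proj₁ (proj₂ w))

    steps-sum : sumL steps ≡ x
    steps-sum = trans (sym (sumV-toList (proj₁ w))) (proj₂ (proj₂ w))

    steps-length : length steps ≡ m
    steps-length = VecP.length-toList (proj₁ w)

  constant-vector : ∀ {A : Set} {e : A} {n} (s : Vec A n) → All (_≡ e) (toList s) → s ≡ Vec.replicate n e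
  constant-vector [] [] = refl
  constant-vector (a ∷ s) (refl ∷ all-e) = cong (a ∷_) (constant-vector s all-e)

  scale-< : ∀ {D m t} → 0ℤ < D → m ℕ.< t → + m * D < + t * D
  scale-< {+[1+ d ]} _ m<t = ℤP.*-monoʳ-<-pos +[1+ d ] (+<+ m<t)
  scale-< {+ 0} (+<+ ()) _

  scale-≤ : ∀ {D m t} → 0ℤ < D → m ℕ.≤ t → + m * D ≤ + t * D
  scale-≤ {+[1+ d ]} _ m≤t = ℤP.*-monoʳ-≤-nonNeg +[1+ d ] (+≤+ m≤t)
  scale-≤ {+ 0} (+<+ ()) _

  vertex⇒primary : ∀ {S : List (G k)} {e} → Vertex S e → Primary S e
  vertex⇒primary {k} {S} {e} (e∈S , c , D>0 , supports) = e∈S , λ t → (straight t , no-shorter t) , unique t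
    where
    open Supporting S e c supports

    straight-steps : ∀ t → VecAll.All (_∈ S) (Vec.replicate t e)
    straight-steps zero = VecAll.[]
    straight-steps (suc t) = e∈S VecAll.∷ straight-steps t

    straight : ∀ t → Walk S t ((+ t) · e)
    straight t = Vec.replicate t e , straight-steps t ,
      trans (sumV-toList (Vec.replicate t e)) (trans (cong sumL (VecP.toList-replicate t e)) (sumL-replicate t e))

    value : ∀ {m t} (w : Walk S m ((+ t) · e)) → dot c (sumL (Steps.steps w)) ≡ + t * D
    value {t = t} w = trans (cong (dot c) (Steps.steps-sum w)) (dot-· c (+ t) e)

    no-shorter : ∀ t m → m ℕ.< t → ¬ Walk S m ((+ t) · e)
    no-shorter t m m<t w = ℤP.<⇒≱ (scale-< D>0 m<t)
      (subst₂ _≤_ (value {t = t} w) (cong (λ n → + n * D) (Steps.steps-length w)) (sum-bound-≤ _ (Steps.steps-in w)))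

    straight-only : ∀ t (w : Walk S t ((+ t) · e)) → proj₁ w ≡ Vec.replicate t e
    straight-only t w with sum-bound (Steps.steps w) (Steps.steps-in w)
    ... | inj₁ all-e = constant-vector (proj₁ w) all-e
    ... | inj₂ below = ⊥-elim (ℤP.<-irrefl refl
            (subst₂ _<_ (value {t = t} w) (cong (λ n → + n * D) (Steps.steps-length w)) below))

    unique : ∀ t → UniqueWalk S t ((+ t) · e)
    unique t w w′ = trans (straight-only t w) (sym (straight-only t w′))

module Representation where

  open import Defs
  open Lattice
  open Gordan using (gordan; PositiveFunctional)
  open Vertices using (Vertex; module Supporting; scale-<; scale-≤)
  open import Data.Nat as ℕ using (ℕ; zero; suc; z≤n; s≤s)
  import Data.Nat.Properties as ℕP
  open import Data.Integer using (+_; 0ℤ; _+_; _*_; _-_; _<_)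
  import Data.Integer.Properties as ℤP
  open import Data.Integer.Tactic.RingSolver using (solve-∀)
  import Data.Vec.Properties as VecP
  open import Data.Maybe using (Maybe; just; nothing)
  import Data.Maybe.Relation.Unary.All as MaybeAll
  open import Data.List using (List; []; _∷_; _++_; length; map; filter; catMaybes)
  import Data.List.Properties as ListP
  open import Data.List.Membership.Propositional using (_∈_)
  open import Data.List.Membership.Propositional.Properties using (∈-filter⁺; ∈-filter⁻; ∈-map⁺; ∈-map⁻)
  open import Data.List.Relation.Unary.All as All using (All; []; _∷_)
  open import Data.List.Relation.Unary.All.Properties using (++⁺; All-catMaybes⁺)
  import Data.List.Relation.Unary.Any as Any
  open import Data.List.Relation.Unary.Any using (here; there)
  open import Data.Product using (Σ; _×_; _,_; proj₁; ∃-syntax)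
  open import Data.Sum using (_⊎_; inj₁; inj₂)
  open import Relation.Nullary using (Dec; yes; no; ¬?)
  open import Relation.Binary.PropositionalEquality

  private variable k : ℕ

  Spanned : (G k → Set) → ℕ → ℕ → G k → Set
  Spanned {k} P n K y = Σ (List (G k)) λ ps → length ps ℕ.≤ K ℕ.* n × All P ps × sumL ps ≡ (+ K) · y

  Representable : (G k → Set) → G k → Set
  Representable {k} P y = ∃[ K ] (K ℕ.> 0 × ∃[ ps ] (length ps ℕ.≤ K × All P ps × sumL ps ≡ (+ K) · y))

  representable-mono : ∀ {P Q : G k → Set} {y} → (∀ {p} → P p → Q p) → Representable P y → Representable Q y
  representable-mono P⇒Q (K , K>0 , ps , short , all-P , sum) = K , K>0 , ps , short , All.map P⇒Q all-P , sum

  *-positive : ∀ {m n} → 0 ℕ.< m → 0 ℕ.< n → 0 ℕ.< m ℕ.* n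
  *-positive {suc m} {suc n} _ _ = s≤s z≤n

  spanned-scale : ∀ {P : G k → Set} {n K y} m → Spanned P n K y → Spanned P n (m ℕ.* K) y
  spanned-scale {n = n} {K} {y} m (ps , short , all-P , sum) =
    copies m ps , short′ , All-copies m all-P , sum′
    where
    short′ : length (copies m ps) ℕ.≤ m ℕ.* K ℕ.* n
    short′ = begin
      length (copies m ps)   ≡⟨ length-copies m ps ⟩
      m ℕ.* length ps        ≤⟨ ℕP.*-monoʳ-≤ m short ⟩
      m ℕ.* (K ℕ.* n)        ≡⟨ ℕP.*-assoc m K n ⟨
      m ℕ.* K ℕ.* n          ∎
      where open ℕP.≤-Reasoning
    sum′ : sumL (copies m ps) ≡ (+ (m ℕ.* K)) · y
    sum′ = begin
      sumL (copies m ps)     ≡⟨ sumL-copies m ps ⟩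
      (+ m) · sumL ps        ≡⟨ cong ((+ m) ·_) sum ⟩
      (+ m) · (+ K) · y      ≡⟨ ·-assoc (+ m) (+ K) y ⟨
      (+ m * + K) · y        ≡⟨ cong (_· y) (ℤP.pos-* m K) ⟨
      (+ (m ℕ.* K)) · y      ∎
      where open ≡-Reasoning

  spanned-⊕ : ∀ {P : G k → Set} {n n′ K y z} → Spanned P n K y → Spanned P n′ K z → Spanned P (n ℕ.+ n′) K (y ⊕ z)
  spanned-⊕ {n = n} {n′} {K} {y} {z} (ps , short , all-P , sum) (qs , short′ , all-P′ , sum′) =
    ps ++ qs , short″ , ++⁺ all-P all-P′ , sum″
    where
    short″ : length (ps ++ qs) ℕ.≤ K ℕ.* (n ℕ.+ n′)
    short″ = begin
      length (ps ++ qs)           ≡⟨ ListP.length-++ ps ⟩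
      length ps ℕ.+ length qs     ≤⟨ ℕP.+-mono-≤ short short′ ⟩
      K ℕ.* n ℕ.+ K ℕ.* n′        ≡⟨ ℕP.*-distribˡ-+ K n n′ ⟨
      K ℕ.* (n ℕ.+ n′)            ∎
      where open ℕP.≤-Reasoning
    sum″ : sumL (ps ++ qs) ≡ (+ K) · (y ⊕ z)
    sum″ = begin
      sumL (ps ++ qs)             ≡⟨ sumL-++ ps qs ⟩
      sumL ps ⊕ sumL qs           ≡⟨ cong₂ _⊕_ sum sum′ ⟩
      (+ K) · y ⊕ (+ K) · z       ≡⟨ ·-distribˡ-⊕ (+ K) y z ⟨
      (+ K) · (y ⊕ z)             ∎
      where open ≡-Reasoning

  spanned-sum : ∀ {P : G k → Set} ys → All (Representable P) ys →
                Σ ℕ λ K → K ℕ.> 0 × Spanned P (length ys) K (sumL ys)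
  spanned-sum [] [] = 1 , s≤s z≤n , [] , z≤n , [] , sym (·-zeroʳ (+ 1))
  spanned-sum {P = P} (y ∷ ys) ((K₁ , K₁>0 , ps , short , all-P , sum) ∷ reps) with spanned-sum ys reps
  ... | K₂ , K₂>0 , spanned-ys =
    K₂ ℕ.* K₁ , *-positive K₂>0 K₁>0 ,
    spanned-⊕ {n = 1} {K = K₂ ℕ.* K₁} (spanned-scale K₂ spanned-y)
              (subst (λ K → Spanned P (length ys) K (sumL ys)) (ℕP.*-comm K₁ K₂) (spanned-scale K₁ spanned-ys))
    where
    spanned-y : Spanned P 1 K₁ y
    spanned-y = ps , subst (length ps ℕ.≤_) (sym (ℕP.*-identityʳ K₁)) short , all-P , sum

  representable-self : ∀ {P : G k → Set} {y} → P y → Representable P y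
  representable-self {y = y} Py = 1 , s≤s z≤n , y ∷ [] , s≤s z≤n , Py ∷ [] ,
    trans (cong (y ⊕_) (sym (·-zeroˡ y))) (sym (·-suc 0 y))

  representable-from-multiple : ∀ {P : G k → Set} {n r K x} → K ℕ.> 0 → r ℕ.> 0 → n ℕ.≤ r →
                                Spanned P n K ((+ r) · x) → Representable P x
  representable-from-multiple {n = n} {r} {K} {x} K>0 r>0 n≤r (ps , short , all-P , sum) =
    K ℕ.* r , *-positive K>0 r>0 , ps , ℕP.≤-trans short (ℕP.*-monoʳ-≤ K n≤r) , all-P ,
    trans sum (trans (sym (·-assoc (+ K) (+ r) x)) (cong (_· x) (sym (ℤP.pos-* K r))))

  module Step {k} (S : List (G k)) {x} (x∈S : x ∈ S) where

    _≟_ : (s t : G k) → Dec (s ≡ t)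
    _≟_ = VecP.≡-dec ℤP._≟_

    T : List (G k)
    T = filter (λ s → ¬? (s ≟ x)) S

    T-smaller : length T ℕ.< length S
    T-smaller = ListP.filter-notAll (λ s → ¬? (s ≟ x)) S (Any.map (λ x≡s s≢x → s≢x (sym x≡s)) x∈S)

    T⊆S : ∀ {s} → s ∈ T → s ∈ S
    T⊆S s∈T = proj₁ (∈-filter⁻ (λ s → ¬? (s ≟ x)) s∈T)

    S⊆x∷T : ∀ {s} → s ∈ S → s ≡ x ⊎ s ∈ T
    S⊆x∷T {s} s∈S with s ≟ x
    ... | yes s≡x = inj₁ s≡x
    ... | no s≢x = inj₂ (∈-filter⁺ (λ s → ¬? (s ≟ x)) s∈S s≢x)

    v : Maybe (G k) → G k
    v nothing = x
    v (just t) = x ⊕ ⊖ t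

    W : List (Maybe (G k))
    W = nothing ∷ map just T

    v-sum : ∀ Lc → sumL (map v Lc) ⊕ sumL (catMaybes Lc) ≡ (+ length Lc) · x
    v-sum [] = trans (⊕-identityʳ 0G) (sym (·-zeroˡ x))
    v-sum (nothing ∷ Lc) =
      trans (⊕-assoc x _ _) (trans (cong (x ⊕_) (v-sum Lc)) (sym (·-suc (length Lc) x)))
    v-sum (just t ∷ Lc) =
      trans (⊕-interchange (x ⊕ ⊖ t) _ t _)
        (trans (cong₂ _⊕_ (⊖-cancelʳ x t) (v-sum Lc)) (sym (·-suc (length Lc) x)))

    x-vertex : PositiveFunctional v W → Vertex S x
    x-vertex (c , positive) = x∈S , c , positive (here refl) , below
      where
      difference : ∀ s → dot c (x ⊕ ⊖ s) ≡ dot c x - dot c s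
      difference s = trans (dot-⊕ c x (⊖ s)) (cong (λ y → dot c x + y) (dot-⊖ c s))
      sub-pos : ∀ a b → 0ℤ < a - b → b < a
      sub-pos a b 0<a-b = subst₂ _<_ (ℤP.+-identityʳ b) (cancel a b) (ℤP.+-monoʳ-< b 0<a-b)
        where
        cancel : ∀ a b → b + (a - b) ≡ a
        cancel = solve-∀
      below : ∀ {s} → s ∈ S → s ≡ x ⊎ dot c s < dot c x
      below {s} s∈S with S⊆x∷T s∈S
      ... | inj₁ s≡x = inj₁ s≡x
      ... | inj₂ s∈T = inj₂ (sub-pos (dot c x) (dot c s) (subst (0ℤ <_) (difference s) (positive (there (∈-map⁺ just s∈T)))))

    module Multiple (Lc : List (Maybe (G k))) (Lc⊆W : All (_∈ W) Lc) (sum≡0 : sumL (map v Lc) ≡ 0G)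
                    (r>0 : 0 ℕ.< length Lc) where

      r : ℕ
      r = length Lc

      LT : List (G k)
      LT = catMaybes Lc

      LT⊆T : All (_∈ T) LT
      LT⊆T = All-catMaybes⁺ (All.map from-W Lc⊆W)
        where
        from-W : ∀ {m} → m ∈ W → MaybeAll.All (_∈ T) m
        from-W (here refl) = MaybeAll.nothing
        from-W (there m∈) with ∈-map⁻ just m∈
        ... | t , t∈T , refl = MaybeAll.just t∈T

      LT-sum : sumL LT ≡ (+ r) · x
      LT-sum = trans (sym (⊕-identityˡ (sumL LT))) (trans (cong (_⊕ sumL LT) (sym sum≡0)) (v-sum Lc))

      LT-short : length LT ℕ.≤ r
      LT-short = ListP.length-catMaybes Lc

      -- a vertex p of T remains a vertex of S: c·x < c·p unless x = p, because
      -- r·(c·x) = c·(Σ LT) ≤ |LT|·(c·p) ≤ r·(c·p)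
      vertex-extend : ∀ {p} → Vertex T p → Vertex S p
      vertex-extend {p} (p∈T , c , D>0 , supports) = T⊆S p∈T , c , D>0 , supports′
        where
        open Supporting T p c supports
        multiple : dot c (sumL LT) ≡ + r * dot c x
        multiple = trans (cong (dot c) LT-sum) (dot-· c (+ r) x)
        cancel : + r * dot c x < + r * D → dot c x < D
        cancel = ℤP.*-cancelˡ-<-nonNeg (+ r)
        x-below : x ≡ p ⊎ dot c x < D
        x-below with sum-bound LT LT⊆T
        ... | inj₂ below = inj₂ (cancel (ℤP.<-≤-trans (subst (_< + length LT * D) multiple below) (scale-≤ D>0 LT-short)))
        ... | inj₁ all-p with ℕP.m≤n⇒m<n∨m≡n LT-short
        ...   | inj₁ shorter = inj₂ (cancel (subst (_< + r * D) (trans (sym (sum-all-e LT all-p)) multiple) (scale-< D>0 shorter)))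
        ...   | inj₂ same = inj₁ (·-cancelˡ r>0 x p (trans (sym LT-sum) (trans (sumL-all-equal LT all-p) (cong (λ n → (+ n) · p) same))))
        supports′ : ∀ {s} → s ∈ S → s ≡ p ⊎ dot c s < D
        supports′ s∈S with S⊆x∷T s∈S
        ... | inj₁ refl = x-below
        ... | inj₂ s∈T = supports s∈T

      representation : (∀ {t} → t ∈ T → Representable (Vertex T) t) → Representable (Vertex S) x
      representation ih with spanned-sum LT (All.map ih LT⊆T)
      ... | K , K>0 , spanned = representable-mono vertex-extend
              (representable-from-multiple K>0 r>0 LT-short (subst (Spanned (Vertex T) (length LT) K) LT-sum spanned))

    representation : (∀ {t} → t ∈ T → Representable (Vertex T) t) → Representable (Vertex S) x
    representation ih with gordan k v W
    ... | inj₁ functional = representable-self (x-vertex functional)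
    ... | inj₂ (Lc , r>0 , Lc⊆W , sum≡0) = Multiple.representation Lc Lc⊆W sum≡0 r>0 ih

  vertex-representation : ∀ n (S : List (G k)) → length S ℕ.< n → ∀ {x} → x ∈ S → Representable (Vertex S) x
  vertex-representation zero S () x∈S
  vertex-representation (suc n) S |S|≤n x∈S = Step.representation S x∈S
    (vertex-representation n (Step.T S x∈S) (ℕP.<-≤-trans (Step.T-smaller S x∈S) (ℕP.≤-pred |S|≤n)))

open import Defs
open import Data.Nat using (ℕ; suc; _≤_; _>_)
open import Data.Integer using (+_)
open import Data.List using (List; length)
open import Data.List.Membership.Propositional using (_∈_)
open import Data.List.Relation.Unary.All using (All)
open import Data.Product using (_×_; ∃-syntax)
open import Relation.Binary.PropositionalEquality using (_≡_)
open import Relation.Nullary using (¬_)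
open import Data.Nat.Properties using (≤-refl)
open Vertices using (vertex⇒primary)
open Representation using (vertex-representation; representable-mono)

proposition6 : (k : ℕ) → k > 0 → (𝒜 : List (G k)) →
    Symmetric 𝒜 → ¬ (0G ∈ 𝒜) → Generates 𝒜 →
    ∀ x → x ∈ 𝒜 →
    ∃[ K ] (K > 0 × ∃[ ps ] (length ps ≤ K × All (Primary 𝒜) ps × sumL ps ≡ (+ K) · x))
proposition6 k _ 𝒜 _ _ _ x x∈𝒜 =
  representable-mono vertex⇒primary (vertex-representation (suc (length 𝒜)) 𝒜 ≤-refl x∈𝒜)
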